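{- For every object $X$ of $\mathcal{S}$, the formula $\forall f:X^X.\ \mathrm{Contr}(f)\to\exists n:N.\ \forall x,x':X.\ f^n(x)=f^n(x')$ holds in the internal logic of $\mathcal{S}$.
   Context: $\mathcal{S}$ is the topos of presheaves on $\omega=\{1,2,\dots\}$; $N$ is its natural numbers object (the constant presheaf of natural numbers) and $f^n$ is the internally defined $n$-fold iterate of $f$. $\Omega(n)=\{0,\dots,n\}$ and $\rhd:\Omega\to\Omega$ maps $k\in\Omega(m)$ to $\min(m,k+1)$. The internal logic is Kripke–Joyal forcing (a formula holds if forced at every stage). $\mathrm{Contr}(f)\Leftrightarrow\forall x,x':X.\ \rhd(x=x')\to f(x)=f(x')$. -}

module Defs where

open import Data.Nat using (ℕ; zero; suc; _≤_)
open import Data.Nat.Properties using (<⇒≤)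
open import Data.Product using (Σ)
open import Data.Unit using (⊤)
open import Function using (id; _∘_)
open import Relation.Binary.PropositionalEquality using (_≡_)

-- Stages of ω = {1,2,...} are represented by ℕ with an offset:
-- the index i : ℕ stands for the stage i+1 ∈ ω.

-- An object of 𝒮 = presheaves (of sets) on ω: a set at every stage
-- together with restriction maps X(i+2) → X(i+1).
record Presheaf : Set₁ where
  field
    ob    : ℕ → Set
    restr : (i : ℕ) → ob (suc i) → ob i
open Presheaf public

iter : {A : Set} → ℕ → (A → A) → A → A
iter zero    g = id
iter (suc n) g = g ∘ iter n g

-- Elements of the exponential X^X at stage m: natural transformations
-- y(m) × X → X, i.e. endomaps f_k of X(k) for every stage k ≤ m,
-- commuting with the restriction maps.
record Exp (X : Presheaf) (m : ℕ) : Set where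
  field
    fun : (k : ℕ) → k ≤ m → ob X k → ob X k
    nat : (k : ℕ) (p : suc k ≤ m) (x : ob X (suc k)) →
          restr X k (fun (suc k) p x) ≡ fun k (<⇒≤ p) (restr X k x)
open Exp public

-- The truth value of x = x' at stage s (∈ Ω(s) = {0,…,s}) is the largest
-- j ≤ s with x|_j = x'|_j; ▷ sends it to min(s, j+1), which is the top
-- element s iff s = 1 or x|_{s-1} = x'|_{s-1}.
ForcesLaterEq : (X : Presheaf) (k : ℕ) → ob X k → ob X k → Set
ForcesLaterEq X zero    x x' = ⊤
ForcesLaterEq X (suc j) x x' = restr X j x ≡ restr X j x'

ForcesContr : (X : Presheaf) (m : ℕ) → Exp X m → Set
ForcesContr X m f =
  (k : ℕ) (p : k ≤ m) (x x' : ob X k) →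
  ForcesLaterEq X k x x' → fun f k p x ≡ fun f k p x'

-- Stage m forces ∃ n : N. ∀ x x' : X. fⁿ(x) = fⁿ(x')
-- (N is the constant presheaf ℕ; existentials in a presheaf topos are local).
ForcesEventuallyConst : (X : Presheaf) (m : ℕ) → Exp X m → Set
ForcesEventuallyConst X m f =
  Σ ℕ λ n → (k : ℕ) (p : k ≤ m) (x x' : ob X k) →
  iter n (fun f k p) x ≡ iter n (fun f k p) x'

module Submission where

-- Fix a stage m and f ∈ (X^X)(m) forcing Contr(f), with
-- components f_k : X(k) → X(k) for k ≤ m.  At stage k, Contr(f) says that
-- f_k identifies any two elements whose restrictions to stage k-1 agree
-- (and, at the bottom stage, any two elements at all).  We show by
-- induction on k that the iterate f_k^(k+1) is constant:
--   * at k = 0, f_0 itself is constant;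
--   * at k+1, restriction commutes with iterates of f (naturality), so the
--     restrictions of f_{k+1}^(k+1) x and f_{k+1}^(k+1) x' are
--     f_k^(k+1) of restrictions, hence equal by induction; one more
--     application of f_{k+1} then makes the two values equal.
-- Since agreement of iterates persists under further iteration, the single
-- witness n = m+1 works at every stage k ≤ m, which is what stage m must
-- force for the existential.

open import Defs
open import Data.Nat using (ℕ; zero; suc; _≤_; _≤′_; ≤′-refl; ≤′-step; s≤s)
open import Data.Nat.Properties using (≤-irrelevant; <⇒≤; ≤⇒≤′)
open import Data.Product using (_,_)
open import Data.Unit using (tt)
open import Relation.Binary.PropositionalEquality
open ≡-Reasoning

-- If r intertwines g and h (r ∘ g = h ∘ r) then it intertwines all their
-- iterates; this transports iterates of f along restriction maps.
iter-intertwine : {A B : Set} (g : A → A) (h : B → B) (r : A → B) →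
  (∀ a → r (g a) ≡ h (r a)) →
  (j : ℕ) (a : A) → r (iter j g a) ≡ iter j h (r a)
iter-intertwine g h r comm zero    a = refl
iter-intertwine g h r comm (suc j) a = begin
  r (g (iter j g a))    ≡⟨ comm (iter j g a) ⟩
  h (r (iter j g a))    ≡⟨ cong h (iter-intertwine g h r comm j a) ⟩
  h (iter j h (r a))    ∎

iter-agree-mono : {A : Set} (g : A → A) (a a' : A) {j n : ℕ} → j ≤′ n →
  iter j g a ≡ iter j g a' → iter n g a ≡ iter n g a'
iter-agree-mono g a a' ≤′-refl        e = e
iter-agree-mono g a a' (≤′-step j≤n) e = cong g (iter-agree-mono g a a' j≤n e)

-- Naturality of an element of X^X, stated for an arbitrary proof that the
-- lower stage lies below m (the proof of k ≤ m is irrelevant).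
restr-fun : (X : Presheaf) {m : ℕ} (f : Exp X m) (k : ℕ)
  (p : suc k ≤ m) (q : k ≤ m) (x : ob X (suc k)) →
  restr X k (fun f (suc k) p x) ≡ fun f k q (restr X k x)
restr-fun X f k p q x = begin
  restr X k (fun f (suc k) p x)          ≡⟨ nat f k p x ⟩
  fun f k (<⇒≤ p) (restr X k x)          ≡⟨ cong (λ r → fun f k r (restr X k x)) (≤-irrelevant (<⇒≤ p) q) ⟩
  fun f k q (restr X k x)                ∎

restr-iter : (X : Presheaf) {m : ℕ} (f : Exp X m) (k : ℕ)
  (p : suc k ≤ m) (q : k ≤ m) (j : ℕ) (x : ob X (suc k)) →
  restr X k (iter j (fun f (suc k) p) x) ≡ iter j (fun f k q) (restr X k x)
restr-iter X f k p q = iter-intertwine _ _ (restr X k) (restr-fun X f k p q)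

iter-const-at-stage : (X : Presheaf) (m : ℕ) (f : Exp X m) → ForcesContr X m f →
  (k : ℕ) (p : k ≤ m) (x x' : ob X k) →
  iter (suc k) (fun f k p) x ≡ iter (suc k) (fun f k p) x'
iter-const-at-stage X m f contr zero p x x' = contr zero p x x' tt
iter-const-at-stage X m f contr (suc k) p x x' =
  contr (suc k) p _ _ restrictions-agree
  where
  q : k ≤ m
  q = <⇒≤ p

  restrictions-agree :
    restr X k (iter (suc k) (fun f (suc k) p) x) ≡
    restr X k (iter (suc k) (fun f (suc k) p) x')
  restrictions-agree = begin
    restr X k (iter (suc k) (fun f (suc k) p) x)  ≡⟨ restr-iter X f k p q (suc k) x ⟩
    iter (suc k) (fun f k q) (restr X k x)        ≡⟨ iter-const-at-stage X m f contr k q _ _ ⟩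
    iter (suc k) (fun f k q) (restr X k x')       ≡⟨ restr-iter X f k p q (suc k) x' ⟨
    restr X k (iter (suc k) (fun f (suc k) p) x') ∎

lemma2p10 : (X : Presheaf) (m : ℕ) (f : Exp X m) →
    ForcesContr X m f → ForcesEventuallyConst X m f
lemma2p10 X m f contr = suc m , λ k p x x' →
  iter-agree-mono (fun f k p) x x' (≤⇒≤′ (s≤s p))
    (iter-const-at-stage X m f contr k p x x')
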